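{- Let $f_1=1$, $f_2=1$ and $f_{i+2}=f_i+f_{i+1}$ be the Fibonacci numbers, and let $n$ be a positive integer (the finger count). If there exists an integer $i$ such that $f_{2i}\leqslant n<f_{2i+1}$, then the Simple Chopsticks position $[1]\,[1]_n$ (each player has one hand with one raised finger) is an $\mathcal{N}$-position (next player wins); otherwise it is a $\mathcal{P}$-position (previous player wins).
   Context: Simple Chopsticks (the paper's generalization of Chopsticks). Fix a positive integer $n$, the finger count. A position $[x_1,\ldots,x_\ell]\,[y_1,\ldots,y_r]_n$ consists of a finite non-decreasing sequence $(x_1,\ldots,x_\ell)$ of integers in $\{1,\ldots,n\}$ (Left's hands, $x_i$ = number of raised fingers) and a finite non-decreasing sequence $(y_1,\ldots,y_r)$ of integers in $\{1,\ldots,n\}$ (Right's hands); either list may be empty. Left's moves: for any $i\in\{1,\ldots,\ell\}$ and $j\in\{1,\ldots,r\}$, replace $y_j$ by $y_j+x_i$ (re-sorting), and if $y_j+x_i>n$ remove that entry from Right's list instead. Right's moves: for any $i,j$, replace $x_i$ by $x_i+y_j$, removing it if $x_i+y_j>n$. In particular no moves are available when either list is empty. The game is played under normal play: a player who cannot move on their turn loses. Outcome classes: $\mathcal{N}$ = the player moving first wins; $\mathcal{P}$ = the player moving second wins; $\mathcal{L}$ = Left wins whoever moves first; $\mathcal{R}$ = Right wins whoever moves first. -}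

module Defs where

open import Data.Nat using (ℕ; zero; suc; _+_; _≤_; _<_; _≤?_)
open import Data.Fin using (Fin; zero; suc)
open import Data.List using (List; []; _∷_; length; lookup)
open import Data.Product using (_×_; ∃-syntax)
open import Relation.Nullary using (yes; no)

-- Fibonacci numbers: fib 1 = 1, fib 2 = 1, fib (i+2) = fib i + fib (i+1)
-- (fib 0 = 0 is only an auxiliary value).
fib : ℕ → ℕ
fib zero = zero
fib (suc zero) = suc zero
fib (suc (suc i)) = fib i + fib (suc i)

-- The hands of a player are kept as a list of finger counts.  The paper keeps
-- them sorted; the order of hands is irrelevant to the game, so we do not sort.

removeAt : (ys : List ℕ) → Fin (length ys) → List ℕ
removeAt (y ∷ ys) zero = ys
removeAt (y ∷ ys) (suc j) = y ∷ removeAt ys j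

replaceAt : (ys : List ℕ) → Fin (length ys) → ℕ → List ℕ
replaceAt (y ∷ ys) zero v = v ∷ ys
replaceAt (y ∷ ys) (suc j) v = y ∷ replaceAt ys j v

hit : (n : ℕ) (x : ℕ) (ys : List ℕ) → Fin (length ys) → List ℕ
hit n x ys j with lookup ys j + x ≤? n
... | yes _ = replaceAt ys j (lookup ys j + x)
... | no _  = removeAt ys j

-- Positions from the point of view of the player to move:
--   Win  n mine theirs : the player to move (hands 'mine') wins,
--   Lose n mine theirs : the player to move loses (the other player wins).
-- Normal play: a player with no available move loses.
data Win (n : ℕ) (mine theirs : List ℕ) : Set
data Lose (n : ℕ) (mine theirs : List ℕ) : Set

data Win n mine theirs where
  win : (i : Fin (length mine)) (j : Fin (length theirs)) →
        Lose n (hit n (lookup mine i) theirs j) mine → Win n mine theirs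

data Lose n mine theirs where
  lose : ((i : Fin (length mine)) (j : Fin (length theirs)) →
          Win n (hit n (lookup mine i) theirs j) mine) → Lose n mine theirs

-- Outcome classes of the position [xs] [ys]_n (xs = Left's hands, ys = Right's).
-- N: whoever moves first wins.
IsN : ℕ → List ℕ → List ℕ → Set
IsN n xs ys = Win n xs ys × Win n ys xs

IsP : ℕ → List ℕ → List ℕ → Set
IsP n xs ys = Lose n xs ys × Lose n ys xs

FibCond : ℕ → Set
FibCond n = ∃[ i ] (1 ≤ i × fib (i + i) ≤ n × n < fib (suc (i + i)))

module Submission where

open import Defs
open import Data.Bool using (Bool; true; false; not)
open import Data.Bool.Properties using (not-involutive)
open import Data.Nat using (ℕ; zero; suc; _+_; _≤_; _<_; _<?_; _≤?_; z≤n; s≤s)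
open import Data.Nat.Properties using (+-suc; +-comm; +-mono-≤; m≤n+m; ≤-trans; ≤-antisym; <⇒≱; ≮⇒≥; suc-injective)
open import Data.Fin using (zero)
open import Data.List using (List; []; _∷_; lookup)
open import Data.Product using (_×_; _,_; ∃-syntax)
open import Function using (_⇔_; mk⇔; Equivalence)
open import Relation.Binary.Core using (_Preserves_⟶_)
open import Relation.Binary.PropositionalEquality using (_≡_; refl; sym; trans; cong; subst)
open import Relation.Nullary using (¬_; yes; no; contradiction)

-- With one hand each the play is forced: the mover's hand a is added to the
-- opponent's hand b, so from [1] [1] the hands run through consecutive
-- Fibonacci numbers.  If n lies in [f_m, f_{m+1}), the first hand to exceed n
-- is created by the (m-1)-th move, which is made by the first player exactly
-- when m is even.

hit-within : ∀ {n x} ys j → lookup ys j + x ≤ n → hit n x ys j ≡ replaceAt ys j (lookup ys j + x)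
hit-within {n} {x} ys j within with lookup ys j + x ≤? n
... | yes _      = refl
... | no  beyond = contradiction within beyond

hit-beyond : ∀ {n x} ys j → ¬ lookup ys j + x ≤ n → hit n x ys j ≡ removeAt ys j
hit-beyond {n} {x} ys j beyond with lookup ys j + x ≤? n
... | yes within = contradiction within beyond
... | no  _      = refl

lose-without-hands : ∀ {n theirs} → Lose n [] theirs
lose-without-hands = lose λ ()

Outcome : Bool → ℕ → List ℕ → List ℕ → Set
Outcome true  = Win
Outcome false = Lose

module _ {n a b : ℕ} where

  win-by-capture : ¬ b + a ≤ n → Win n (a ∷ []) (b ∷ [])
  win-by-capture beyond =
    win zero zero (subst (λ ys → Lose n ys (a ∷ [])) (sym (hit-beyond (b ∷ []) zero beyond)) lose-without-hands)

  outcome-flip : ∀ v → b + a ≤ n → Outcome v n (b + a ∷ []) (a ∷ []) → Outcome (not v) n (a ∷ []) (b ∷ [])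
  outcome-flip v within = flip v
    where
    after-hit : hit n a (b ∷ []) zero ≡ b + a ∷ []
    after-hit = hit-within (b ∷ []) zero within
    flip : ∀ v → Outcome v n (b + a ∷ []) (a ∷ []) → Outcome (not v) n (a ∷ []) (b ∷ [])
    flip true  w = lose λ { zero zero → subst (λ ys → Win n ys (a ∷ [])) (sym after-hit) w }
    flip false l = win zero zero (subst (λ ys → Lose n ys (a ∷ [])) (sym after-hit) l)

even : ℕ → Bool
even zero    = true
even (suc m) = not (even m)

suc+suc : ∀ h → suc h + suc h ≡ suc (suc (h + h))
suc+suc h = cong suc (+-suc h h)

even-double : ∀ h → even (h + h) ≡ true
even-double zero    = refl
even-double (suc h) rewrite +-suc h h | even-double h = refl

even⇒double : ∀ d → even d ≡ true → ∃[ h ] d ≡ h + h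
even⇒double zero          _  = zero , refl
even⇒double (suc zero)    ()
even⇒double (suc (suc d)) ev with even⇒double d (trans (sym (not-involutive (even d))) ev)
... | h , refl = suc h , sym (suc+suc h)

fib-pos : ∀ k → 1 ≤ fib (suc k)
fib-pos zero    = s≤s z≤n
fib-pos (suc k) = ≤-trans (fib-pos k) (m≤n+m (fib (suc k)) (fib k))

fib-mono : fib Preserves _≤_ ⟶ _≤_
fib-mono z≤n               = z≤n
fib-mono (s≤s {n = k} z≤n) = fib-pos k
fib-mono (s≤s (s≤s p))     = +-mono-≤ (fib-mono p) (fib-mono (s≤s p))

n<fib[2+n] : ∀ n → n < fib (2 + n)
n<fib[2+n] zero    = s≤s z≤n
n<fib[2+n] (suc n) = +-mono-≤ (fib-pos n) (n<fib[2+n] n)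

Bracket : (ℕ → ℕ) → ℕ → ℕ → Set
Bracket f n m = f m ≤ n × n < f (suc m)

bracket-exists : ∀ (f : ℕ → ℕ) {n} b → f 0 ≤ n → n < f b → ∃[ m ] Bracket f n m
bracket-exists f zero    f0≤n n<f0 = contradiction f0≤n (<⇒≱ n<f0)
bracket-exists f (suc b) f0≤n n<fsb with _ <? f b
... | yes n<fb = bracket-exists f b f0≤n n<fb
... | no  n≮fb = b , ≮⇒≥ n≮fb , n<fsb

module _ {f : ℕ → ℕ} (mono : f Preserves _≤_ ⟶ _≤_) {n : ℕ} where

  ≤-bracket : ∀ {m m'} → f m' ≤ n → n < f (suc m) → m' ≤ m
  ≤-bracket fm'≤n n<fsm = ≮⇒≥ λ m<m' → <⇒≱ n<fsm (≤-trans (mono m<m') fm'≤n)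

  bracket-unique : ∀ {m m'} → Bracket f n m → Bracket f n m' → m ≡ m'
  bracket-unique (fm≤n , n<fsm) (fm'≤n , n<fsm') =
    ≤-antisym (≤-bracket fm≤n n<fsm') (≤-bracket fm'≤n n<fsm)

-- From hands fib (suc k) against fib k, exactly d moves stay within n; the next one captures.
fib-play-outcome : ∀ {n} d k → Bracket fib n (d + suc k) →
  Outcome (even d) n (fib (suc k) ∷ []) (fib k ∷ [])
fib-play-outcome zero    k (_ , n<fib) = win-by-capture (<⇒≱ n<fib)
fib-play-outcome (suc d) k br@(fib≤n , _) =
  outcome-flip (even d) within (fib-play-outcome d (suc k) (subst (Bracket fib _) (sym (+-suc d (suc k))) br))
  where
  within : fib k + fib (suc k) ≤ _
  within = ≤-trans (fib-mono (s≤s (m≤n+m (suc k) d))) fib≤n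

fibCond⇔even : ∀ {n} d → Bracket fib n (2 + d) → FibCond n ⇔ (even d ≡ true)
fibCond⇔even {n} d br = mk⇔ to from
  where
  to : FibCond n → even d ≡ true
  to (suc h , _ , br') = subst (λ m → even m ≡ true) h+h≡d (even-double h)
    where
    h+h≡d : h + h ≡ d
    h+h≡d = suc-injective (suc-injective (trans (sym (suc+suc h)) (bracket-unique fib-mono br' br)))
  from : even d ≡ true → FibCond n
  from ev with even⇒double d ev
  ... | h , refl = suc h , s≤s z≤n , subst (Bracket fib n) (sym (suc+suc h)) br

theorem2p1 : (n : ℕ) → 1 ≤ n →
    (FibCond n → IsN n (1 ∷ []) (1 ∷ [])) × (¬ FibCond n → IsP n (1 ∷ []) (1 ∷ []))
theorem2p1 n 1≤n with bracket-exists fib (2 + n) z≤n (n<fib[2+n] n)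
... | zero        , _ , n<1 = contradiction 1≤n (<⇒≱ n<1)
... | suc zero    , _ , n<1 = contradiction 1≤n (<⇒≱ n<1)
... | suc (suc d) , br      =
  classify (even d) (fibCond⇔even d br) (fib-play-outcome d 1 (subst (Bracket fib n) (+-comm 2 d) br))
  where
  classify : ∀ v → FibCond n ⇔ (v ≡ true) → Outcome v n (1 ∷ []) (1 ∷ []) →
    (FibCond n → IsN n (1 ∷ []) (1 ∷ [])) × (¬ FibCond n → IsP n (1 ∷ []) (1 ∷ []))
  classify true  cond w = (λ _ → w , w) , λ ¬cond → contradiction (Equivalence.from cond refl) ¬cond
  classify false cond l = (λ c → contradiction (Equivalence.to cond c) λ ()) , λ _ → l , l
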